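{- Let $B=\{\{a,b\}\mid a,b\in\mathbb V,\ a\neq b\}$ be the nominal set of unordered pairs of distinct atoms (with action $\pi\cdot\{a,b\}=\{\pi(a),\pi(b)\}$). Then there is no functor $F:\mathbf{Nom}\to\mathbf{Nom}$ having a sub-strength together with a natural transformation $q:F\to(-)^B$ all of whose components are surjective.
   Context: $\mathbf{Nom}$ is the category of nominal sets (sets with an action of the group of finite permutations of a fixed infinite set $\mathbb V$ of atoms in which every element $x$ has a finite support; $\mathrm{supp}(x)$ is the least support) and equivariant maps. $X^B$ is the exponential in $\mathbf{Nom}$: finitely supported maps $B\to X$ under $(\pi\star f)(y)=\pi\cdot f(\pi^{ -1}\cdot y)$. For nominal sets $X,Y$, $X<Y=\{(x,y)\in X\times Y\mid\mathrm{supp}(x)\subseteq\mathrm{supp}(y)\}$, with projection $\mathrm{outl}$. A sub-strength of $F$ is a family of equivariant maps $s_{X,Y}:FX<Y\to F(X<Y)$, not necessarily natural, with $F\mathrm{outl}\circ s_{X,Y}=\mathrm{outl}$. -}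

module Defs where

open import Data.Nat using (ℕ)
open import Data.List using (List; []; _∷_; map; _++_)
open import Data.List.Membership.Propositional using (_∈_; _∉_)
open import Data.List.Membership.Propositional.Properties
  using (∈-map⁺; ∈-map⁻; ∈-++⁺ˡ; ∈-++⁺ʳ)
open import Data.List.Relation.Unary.Any using (here; there)
open import Data.Product using (Σ; ∃; _×_; _,_; proj₁; proj₂)
open import Data.Sum using (_⊎_; inj₁; inj₂)
open import Relation.Binary.Core using (Rel)
open import Relation.Binary.Structures using (IsEquivalence)
open import Relation.Binary.PropositionalEquality
  using (_≡_; _≢_; refl; sym; trans; cong; subst)

Atom : Set
Atom = ℕ

record Perm : Set where
  field
    to      : Atom → Atom
    from    : Atom → Atom
    to∘from : ∀ a → to (from a) ≡ a
    from∘to : ∀ a → from (to a) ≡ a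
    finite  : ∃ λ (D : List Atom) → ∀ a → a ∉ D → to a ≡ a
open Perm public

idP : Perm
idP = record { to = λ a → a ; from = λ a → a
             ; to∘from = λ _ → refl ; from∘to = λ _ → refl
             ; finite = [] , λ _ _ → refl }

_∘P_ : Perm → Perm → Perm
π ∘P σ = record
  { to = λ a → to π (to σ a)
  ; from = λ a → from σ (from π a)
  ; to∘from = λ a → trans (cong (to π) (to∘from σ (from π a))) (to∘from π a)
  ; from∘to = λ a → trans (cong (from σ) (from∘to π (to σ a))) (from∘to σ a)
  ; finite = (proj₁ (finite π) ++ proj₁ (finite σ)) , λ a a∉ →
      trans (cong (to π) (proj₂ (finite σ) a (λ m → a∉ (∈-++⁺ʳ _ m))))
            (proj₂ (finite π) a (λ m → a∉ (∈-++⁺ˡ m)))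
  }

invP : Perm → Perm
invP π = record
  { to = from π ; from = to π ; to∘from = from∘to π ; from∘to = to∘from π
  ; finite = proj₁ (finite π) , λ a a∉ →
      trans (cong (from π) (sym (proj₂ (finite π) a a∉))) (from∘to π a) }

_≗P_ : Perm → Perm → Set
π ≗P σ = ∀ a → to π a ≡ to σ a

Fixes : List Atom → Perm → Set
Fixes A π = ∀ a → a ∈ A → to π a ≡ a

record Action : Set₁ where
  field
    Carrier : Set
    _≈_     : Rel Carrier _
    isEquivalence : IsEquivalence _≈_
    act     : Perm → Carrier → Carrier
    act-cong : ∀ π {x y} → x ≈ y → act π x ≈ act π y
    act-ext  : ∀ {π σ} → π ≗P σ → ∀ x → act π x ≈ act σ x
    act-id   : ∀ x → act idP x ≈ x
    act-∘    : ∀ π σ x → act (π ∘P σ) x ≈ act π (act σ x)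
  open IsEquivalence isEquivalence public

Supports : (N : Action) → List Atom → Action.Carrier N → Set
Supports N A x = ∀ π → Fixes A π → Action._≈_ N (Action.act N π x) x

supports-resp : (N : Action) → ∀ {A x y} → Action._≈_ N x y →
                Supports N A x → Supports N A y
supports-resp N x≈y h π fx =
  ≈trans (act-cong π (≈sym x≈y)) (≈trans (h π fx) x≈y)
  where open Action N renaming (trans to ≈trans; sym to ≈sym)

supp-act : (N : Action) → ∀ π {A x} → Supports N A x →
           Supports N (map (to π) A) (Action.act N π x)
supp-act N π {A} {x} h σ fσ =
  ≈trans (≈sym (act-∘ σ π x))
  (≈trans (act-ext eq x)
  (≈trans (act-∘ π τ x)
         (act-cong π (h τ fτ))))
  where
  open Action N renaming (trans to ≈trans; sym to ≈sym)
  τ : Perm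
  τ = invP π ∘P (σ ∘P π)
  fτ : Fixes A τ
  fτ a a∈ = trans (cong (from π) (fσ (to π a) (∈-map⁺ (to π) a∈))) (from∘to π a)
  eq : (σ ∘P π) ≗P (π ∘P τ)
  eq a = sym (to∘from π (to σ (to π a)))

_∈supp[_]_ : Atom → (N : Action) → Action.Carrier N → Set
a ∈supp[ N ] x = ∀ A → Supports N A x → a ∈ A

SuppSub : (X Y : Action) → Action.Carrier X → Action.Carrier Y → Set
SuppSub X Y x y = ∀ a → a ∈supp[ X ] x → a ∈supp[ Y ] y

∈supp-act : (N : Action) → ∀ π {b x} → b ∈supp[ N ] x →
            to π b ∈supp[ N ] Action.act N π x
∈supp-act N π {b} {x} hb C hC with ∈-map⁻ (from π) (hb _ s)
  where
  open Action N renaming (trans to ≈trans; sym to ≈sym)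
  back : act (invP π) (act π x) ≈ x
  back = ≈trans (≈sym (act-∘ (invP π) π x))
         (≈trans (act-ext (λ a → from∘to π a) x) (act-id x))
  s : Supports N (map (from π) C) x
  s = supports-resp N back (supp-act N (invP π) hC)
... | c , c∈ , b≡ = subst (_∈ C) (sym (trans (cong (to π) b≡) (to∘from π c))) c∈

∈supp-act⁻ : (N : Action) → ∀ π {a x} → a ∈supp[ N ] Action.act N π x →
             from π a ∈supp[ N ] x
∈supp-act⁻ N π {a} {x} ha D hD with ∈-map⁻ (to π) (ha _ (supp-act N π hD))
... | d , d∈ , a≡ = subst (_∈ D) (sym (trans (cong (from π) a≡) (from∘to π d))) d∈

suppSub-act : (X Y : Action) → ∀ π {x y} → SuppSub X Y x y →
              SuppSub X Y (Action.act X π x) (Action.act Y π y)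
suppSub-act X Y π sub a ha =
  subst (λ b → b ∈supp[ Y ] Action.act Y π _) (to∘from π a)
        (∈supp-act Y π (sub (from π a) (∈supp-act⁻ X π ha)))

record Nominal : Set₁ where
  field
    action  : Action
  open Action action public
  field
    finSupp : ∀ x → ∃ λ (A : List Atom) → Supports action A x

record Equi (X Y : Nominal) : Set where
  private
    module X = Nominal X
    module Y = Nominal Y
  field
    fun   : X.Carrier → Y.Carrier
    cong≈ : ∀ {x x'} → x X.≈ x' → fun x Y.≈ fun x'
    equiv : ∀ π x → fun (X.act π x) Y.≈ Y.act π (fun x)
open Equi public

_≐_ : ∀ {X Y} → Equi X Y → Equi X Y → Set
_≐_ {X} {Y} f g = ∀ x → Nominal._≈_ Y (fun f x) (fun g x)

idE : ∀ {X} → Equi X X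
idE {X} = record { fun = λ x → x ; cong≈ = λ e → e
                 ; equiv = λ π x → Nominal.refl X }

_∘E_ : ∀ {X Y Z} → Equi Y Z → Equi X Y → Equi X Z
_∘E_ {X} {Y} {Z} g f = record
  { fun = λ x → fun g (fun f x)
  ; cong≈ = λ e → cong≈ g (cong≈ f e)
  ; equiv = λ π x → Nominal.trans Z (cong≈ g (equiv f π x)) (equiv g π (fun f x)) }

record LtCarrier (X Y : Nominal) : Set where
  constructor ⟨_,_,_⟩
  field
    lft : Nominal.Carrier X
    rgt : Nominal.Carrier Y
    sub : SuppSub (Nominal.action X) (Nominal.action Y) lft rgt
open LtCarrier public

_<N_ : Nominal → Nominal → Nominal
X <N Y = record
  { action = record
    { Carrier = LtCarrier X Y
    ; _≈_ = λ p q → (lft p X.≈ lft q) × (rgt p Y.≈ rgt q)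
    ; isEquivalence = record
      { refl = X.refl , Y.refl
      ; sym = λ (e , f) → X.sym e , Y.sym f
      ; trans = λ (e , f) (e' , f') → X.trans e e' , Y.trans f f' }
    ; act = λ π p → ⟨ X.act π (lft p) , Y.act π (rgt p)
                    , suppSub-act X.action Y.action π (sub p) ⟩
    ; act-cong = λ π (e , f) → X.act-cong π e , Y.act-cong π f
    ; act-ext = λ eq p → X.act-ext eq (lft p) , Y.act-ext eq (rgt p)
    ; act-id = λ p → X.act-id (lft p) , Y.act-id (rgt p)
    ; act-∘ = λ π σ p → X.act-∘ π σ (lft p) , Y.act-∘ π σ (rgt p) }
  ; finSupp = λ p →
      let (A , hA) = X.finSupp (lft p)
          (C , hC) = Y.finSupp (rgt p)
      in (A ++ C) , λ π fπ → hA π (λ a m → fπ a (∈-++⁺ˡ m))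
                           , hC π (λ a m → fπ a (∈-++⁺ʳ A m))
  }
  where
  module X = Nominal X
  module Y = Nominal Y

outl : (X Y : Nominal) → Equi (X <N Y) X
outl X Y = record { fun = lft ; cong≈ = proj₁ ; equiv = λ π p → Nominal.refl X }

record RFun (B X : Nominal) : Set where
  field
    fn      : Nominal.Carrier B → Nominal.Carrier X
    fn-cong : ∀ {y y'} → Nominal._≈_ B y y' → Nominal._≈_ X (fn y) (fn y')
open RFun public

invP-ext : ∀ {π σ} → π ≗P σ → invP π ≗P invP σ
invP-ext {π} {σ} eq a =
  trans (sym (from∘to σ (from π a)))
        (cong (from σ) (trans (sym (eq (from π a))) (to∘from π a)))

FunAct : Nominal → Nominal → Action
FunAct B X = record
  { Carrier = RFun B X
  ; _≈_ = λ f g → ∀ y → fn f y X.≈ fn g y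
  ; isEquivalence = record
    { refl = λ y → X.refl ; sym = λ e y → X.sym (e y)
    ; trans = λ e f y → X.trans (e y) (f y) }
  ; act = λ π f → record
    { fn = λ y → X.act π (fn f (B.act (invP π) y))
    ; fn-cong = λ e → X.act-cong π (fn-cong f (B.act-cong (invP π) e)) }
  ; act-cong = λ π e y → X.act-cong π (e _)
  ; act-ext = λ {π} {σ} eq f y →
      X.trans (X.act-ext eq (fn f (B.act (invP π) y))) (X.act-cong σ (fn-cong f {B.act (invP π) y} {B.act (invP σ) y} (B.act-ext (invP-ext {π} {σ} eq) y)))
  ; act-id = λ f y → X.trans (X.act-id _) (fn-cong f (B.act-id y))
  ; act-∘ = λ π σ f y →
      X.trans (X.act-∘ π σ _)
        (X.act-cong π (X.act-cong σ (fn-cong f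
          (B.trans (B.act-ext {invP (π ∘P σ)} {invP σ ∘P invP π} (λ _ → refl) y)
                   (B.act-∘ (invP σ) (invP π) y)))))
  }
  where
  module B = Nominal B
  module X = Nominal X

Exp : Nominal → Nominal → Nominal
Exp B X = record
  { action = record
    { Carrier = Σ (RFun B X) (λ f → ∃ λ A → Supports F A f)
    ; _≈_ = λ f g → proj₁ f F.≈ proj₁ g
    ; isEquivalence = record
      { refl = λ {f} → F.refl {proj₁ f}
      ; sym = λ {f} {g} → F.sym {proj₁ f} {proj₁ g}
      ; trans = λ {f} {g} {h} → F.trans {proj₁ f} {proj₁ g} {proj₁ h} }
    ; act = λ π (f , A , h) → F.act π f , map (to π) A , supp-act F π {A} {f} h
    ; act-cong = λ π {f} {g} e → F.act-cong π {proj₁ f} {proj₁ g} e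
    ; act-ext = λ eq f → F.act-ext eq (proj₁ f)
    ; act-id = λ f → F.act-id (proj₁ f)
    ; act-∘ = λ π σ f → F.act-∘ π σ (proj₁ f) }
  ; finSupp = λ (f , A , h) → A , h
  }
  where
  F = FunAct B X
  module F = Action F

expMap : (B : Nominal) → ∀ {X Y} → Equi X Y → Equi (Exp B X) (Exp B Y)
expMap B {X} {Y} f = record
  { fun = λ (g , A , h) →
      record { fn = λ y → fun f (fn g y) ; fn-cong = λ e → cong≈ f (fn-cong g e) }
      , A , λ σ fσ y → Y.trans (Y.sym (equiv f σ _)) (cong≈ f (h σ fσ y))
  ; cong≈ = λ e y → cong≈ f (e y)
  ; equiv = λ π g y → equiv f π _
  }
  where
  module Y = Nominal Y

record APair : Set where
  constructor ⦅_,_,_⦆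
  field
    fst  : Atom
    snd  : Atom
    dist : fst ≢ snd
open APair public

_≈B_ : APair → APair → Set
p ≈B q = ((fst p ≡ fst q) × (snd p ≡ snd q)) ⊎ ((fst p ≡ snd q) × (snd p ≡ fst q))

Bpairs : Nominal
Bpairs = record
  { action = record
    { Carrier = APair
    ; _≈_ = _≈B_
    ; isEquivalence = record
      { refl = inj₁ (refl , refl)
      ; sym = λ { (inj₁ (e , f)) → inj₁ (sym e , sym f)
                ; (inj₂ (e , f)) → inj₂ (sym f , sym e) }
      ; trans = λ { (inj₁ (e , f)) (inj₁ (e' , f')) → inj₁ (trans e e' , trans f f')
                  ; (inj₁ (e , f)) (inj₂ (e' , f')) → inj₂ (trans e e' , trans f f')
                  ; (inj₂ (e , f)) (inj₁ (e' , f')) → inj₂ (trans e f' , trans f e')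
                  ; (inj₂ (e , f)) (inj₂ (e' , f')) → inj₁ (trans e f' , trans f e') } }
    ; act = λ π p → ⦅ to π (fst p) , to π (snd p)
                    , (λ e → dist p (trans (sym (from∘to π _))
                                      (trans (cong (from π) e) (from∘to π _)))) ⦆
    ; act-cong = λ π → λ { (inj₁ (e , f)) → inj₁ (cong (to π) e , cong (to π) f)
                         ; (inj₂ (e , f)) → inj₂ (cong (to π) e , cong (to π) f) }
    ; act-ext = λ eq p → inj₁ (eq (fst p) , eq (snd p))
    ; act-id = λ p → inj₁ (refl , refl)
    ; act-∘ = λ π σ p → inj₁ (refl , refl) }
  ; finSupp = λ p → (fst p ∷ snd p ∷ []) , λ π fπ →
      inj₁ (fπ (fst p) (here refl) , fπ (snd p) (there (here refl)))
  }

record Functor : Set₁ where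
  field
    F₀     : Nominal → Nominal
    F₁     : ∀ {X Y} → Equi X Y → Equi (F₀ X) (F₀ Y)
    F-resp : ∀ {X Y} {f g : Equi X Y} → f ≐ g → F₁ f ≐ F₁ g
    F-id   : ∀ {X} → F₁ (idE {X}) ≐ idE {F₀ X}
    F-∘    : ∀ {X Y Z} (g : Equi Y Z) (f : Equi X Y) →
             F₁ (g ∘E f) ≐ (F₁ g ∘E F₁ f)
open Functor public

-- a sub-strength: equivariant maps s : FX < Y → F(X < Y), not
-- necessarily natural, with F outl ∘ s = outl
SubStrength : Functor → Set₁
SubStrength F = (X Y : Nominal) →
  Σ (Equi (F₀ F X <N Y) (F₀ F (X <N Y)))
    (λ s → (F₁ F (outl X Y) ∘E s) ≐ outl (F₀ F X) Y)

record NatTransToExp (F : Functor) (B : Nominal) : Set₁ where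
  field
    η       : ∀ X → Equi (F₀ F X) (Exp B X)
    natural : ∀ {X Y} (f : Equi X Y) → (η Y ∘E F₁ F f) ≐ (expMap B f ∘E η X)
open NatTransToExp public

Surjective : ∀ {X Y} → Equi X Y → Set
Surjective {X} {Y} f = ∀ y → ∃ λ x → Nominal._≈_ Y (fun f x) y

-- Take t ∈ FB with q t = id, pair it with a list of atoms enumerating a
-- support of t, apply the sub-strength s : FB < Lists → F(B < Lists) and
-- then q.  By naturality of q and the law F outl ∘ s = outl this gives a
-- finitely supported g : B → B < Lists with outl ∘ g = id.  No such g
-- exists: for atoms a, b fresh for g, both {a, b} and therefore g {a, b}
-- are fixed by the swap (a b), yet the list component of g {a, b} must
-- contain a, which the swap moves.
module Submission where

open import Defs
open import Data.Empty using (⊥-elim)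
open import Data.Nat using (suc)
open import Data.Nat.Properties using (_≟_; 1+n≰n)
open import Data.List using (List; []; _∷_; _++_; map)
open import Data.List.Extrema.Nat using (max; xs≤max)
open import Data.List.Membership.Propositional using (_∈_; _∉_)
open import Data.List.Membership.Propositional.Properties using (∈-++⁺ˡ; ∈-++⁺ʳ)
open import Data.List.Membership.DecPropositional _≟_ using (_∈?_)
open import Data.List.Properties using (map-cong; map-id; map-∘; map-id-local; ∷-injective)
open import Data.List.Relation.Unary.All as All using (All; []; _∷_)
open import Data.List.Relation.Unary.Any using (here; there)
open import Data.Product using (Σ; _×_; _,_; proj₁; proj₂)
open import Data.Sum using (inj₁; inj₂)
open import Relation.Binary.Bundles using (Setoid)
import Relation.Binary.Reasoning.Setoid as ≈-Reasoning
open import Relation.Nullary using (¬_; yes; no)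
open import Relation.Binary.PropositionalEquality
  using (_≡_; _≢_; refl; sym; trans; cong; subst)

transpose : Atom → Atom → Atom → Atom
transpose a c x with x ≟ a
... | yes _ = c
... | no _ with x ≟ c
...   | yes _ = a
...   | no _ = x

transpose-left : ∀ a c → transpose a c a ≡ c
transpose-left a c with a ≟ a
... | yes _ = refl
... | no a≢a = ⊥-elim (a≢a refl)

transpose-right : ∀ a c → transpose a c c ≡ a
transpose-right a c with c ≟ a
... | yes c≡a = c≡a
... | no _ with c ≟ c
...   | yes _ = refl
...   | no c≢c = ⊥-elim (c≢c refl)

transpose-other : ∀ {a c x} → x ≢ a → x ≢ c → transpose a c x ≡ x
transpose-other {a} {c} {x} x≢a x≢c with x ≟ a
... | yes x≡a = ⊥-elim (x≢a x≡a)
... | no _ with x ≟ c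
...   | yes x≡c = ⊥-elim (x≢c x≡c)
...   | no _ = refl

transpose-involutive : ∀ a c x → transpose a c (transpose a c x) ≡ x
transpose-involutive a c x with x ≟ a
... | yes x≡a = trans (transpose-right a c) (sym x≡a)
... | no x≢a with x ≟ c
...   | yes x≡c = trans (transpose-left a c) (sym x≡c)
...   | no x≢c = transpose-other x≢a x≢c

transposition : Atom → Atom → Perm
transposition a c = record
  { to = transpose a c
  ; from = transpose a c
  ; to∘from = transpose-involutive a c
  ; from∘to = transpose-involutive a c
  ; finite = (a ∷ c ∷ []) , λ x x∉ →
      transpose-other (λ x≡a → x∉ (here x≡a)) (λ x≡c → x∉ (there (here x≡c)))
  }

transposition-fixes : ∀ {a c C} → a ∉ C → c ∉ C → Fixes C (transposition a c)
transposition-fixes a∉C c∉C x x∈C =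
  transpose-other (λ x≡a → a∉C (subst (_∈ _) x≡a x∈C))
                  (λ x≡c → c∉C (subst (_∈ _) x≡c x∈C))

fresh : List Atom → Atom
fresh l = suc (max 0 l)

fresh-∉ : ∀ l → fresh l ∉ l
fresh-∉ l m = 1+n≰n (All.lookup (xs≤max 0 l) m)

-- If every swap of a with a fresh enough atom moves x, then a is in the
-- least support of x: a support C missing a would be fixed by such a swap.
swap-moves⇒∈supp : (N : Action) {a : Atom} {x : Action.Carrier N} (K : List Atom) →
  (∀ c → c ∉ a ∷ K → ¬ Action._≈_ N (Action.act N (transposition a c) x) x) →
  a ∈supp[ N ] x
swap-moves⇒∈supp N {a} K moves C C-supports with a ∈? C
... | yes a∈C = a∈C
... | no a∉C = ⊥-elim (moves c c∉aK (C-supports (transposition a c) (transposition-fixes a∉C c∉C)))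
  where
  c : Atom
  c = fresh (a ∷ K ++ C)
  c∉aK : c ∉ a ∷ K
  c∉aK m = fresh-∉ (a ∷ K ++ C) (∈-++⁺ˡ m)
  c∉C : c ∉ C
  c∉C m = fresh-∉ (a ∷ K ++ C) (∈-++⁺ʳ (a ∷ K) m)

∈supp-resp : (N : Action) {a : Atom} {x y : Action.Carrier N} →
  Action._≈_ N x y → a ∈supp[ N ] x → a ∈supp[ N ] y
∈supp-resp N x≈y a∈supp C C-supports =
  a∈supp C (supports-resp N (Action.sym N x≈y) C-supports)

∈supp-pair : ∀ {a b} (a≢b : a ≢ b) → a ∈supp[ Nominal.action Bpairs ] ⦅ a , b , a≢b ⦆
∈supp-pair {a} {b} a≢b = swap-moves⇒∈supp (Nominal.action Bpairs) {x = p} (b ∷ []) moves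
  where
  open Nominal Bpairs using (_≈_; act)
  p : APair
  p = ⦅ a , b , a≢b ⦆
  moves : ∀ c → c ∉ a ∷ b ∷ [] → ¬ act (transposition a c) p ≈ p
  moves c c∉ (inj₁ (ca≡a , _)) = c∉ (here (trans (sym (transpose-left a c)) ca≡a))
  moves c c∉ (inj₂ (ca≡b , _)) = c∉ (there (here (trans (sym (transpose-left a c)) ca≡b)))

Lists : Nominal
Lists = record
  { action = record
    { Carrier = List Atom
    ; _≈_ = _≡_
    ; isEquivalence = record { refl = refl ; sym = sym ; trans = trans }
    ; act = λ π → map (to π)
    ; act-cong = λ π → cong (map (to π))
    ; act-ext = λ π≗σ → map-cong π≗σ
    ; act-id = map-id
    ; act-∘ = λ π σ → map-∘ }
  ; finSupp = λ l → l , λ π fixes → map-id-local (All.tabulate (λ {a} → fixes a)) }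

map-fixed⇒All : ∀ {f : Atom → Atom} l → map f l ≡ l → All (λ x → f x ≡ x) l
map-fixed⇒All []      _  = []
map-fixed⇒All (x ∷ l) eq with ∷-injective eq
... | fx≡x , fl≡l = fx≡x ∷ map-fixed⇒All l fl≡l

transpose-fixed⇒∉ : ∀ {a c} l → a ≢ c → map (transpose a c) l ≡ l → a ∉ l
transpose-fixed⇒∉ {a} {c} l a≢c fixed a∈l =
  a≢c (trans (sym (All.lookup (map-fixed⇒All l fixed) a∈l)) (transpose-left a c))

∈⇒∈supp : ∀ {a} l → a ∈ l → a ∈supp[ Nominal.action Lists ] l
∈⇒∈supp l a∈l = swap-moves⇒∈supp (Nominal.action Lists) [] λ c c∉ fixed →
  transpose-fixed⇒∉ l (λ a≡c → c∉ (here (sym a≡c))) fixed a∈l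

∈supp⇒∈ : ∀ {a} l → a ∈supp[ Nominal.action Lists ] l → a ∈ l
∈supp⇒∈ l a∈supp = a∈supp l (proj₂ (Nominal.finSupp Lists l))

withSupport : (X : Nominal) → Nominal.Carrier X → LtCarrier X Lists
withSupport X x = ⟨ x , A , (λ a a∈supp → ∈⇒∈supp A (a∈supp A A-supports)) ⟩
  where
  A : List Atom
  A = proj₁ (Nominal.finSupp X x)
  A-supports : Supports (Nominal.action X) A x
  A-supports = proj₂ (Nominal.finSupp X x)

setoid : Nominal → Setoid _ _
setoid X = record { isEquivalence = Nominal.isEquivalence X }

module _ (X : Nominal) where
  open Nominal X using (_≈_; act; act-∘; act-ext; act-id)
  open ≈-Reasoning (setoid X)

  act-inverseˡ : ∀ π x → act (invP π) (act π x) ≈ x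
  act-inverseˡ π x = begin
    act (invP π) (act π x)  ≈⟨ act-∘ (invP π) π x ⟨
    act (invP π ∘P π) x     ≈⟨ act-ext (from∘to π) x ⟩
    act idP x               ≈⟨ act-id x ⟩
    x                       ∎

  act-inverseʳ : ∀ π x → act π (act (invP π) x) ≈ x
  act-inverseʳ π x = begin
    act π (act (invP π) x)  ≈⟨ act-∘ π (invP π) x ⟨
    act (π ∘P invP π) x     ≈⟨ act-ext (to∘from π) x ⟩
    act idP x               ≈⟨ act-id x ⟩
    x                       ∎

  identityExp : Nominal.Carrier (Exp X X)
  identityExp = record { fn = λ x → x ; fn-cong = λ x≈y → x≈y }
              , [] , λ π _ → act-inverseʳ π

module _ (X Y : Nominal) where
  private
    module X = Nominal X
    module Y = Nominal Y
  open ≈-Reasoning (setoid Y)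

  supported-map-preserves-fixed :
    (g : Nominal.Carrier (Exp X Y)) → ∀ π → Fixes (proj₁ (proj₂ g)) π →
    ∀ {x} → X.act π x X.≈ x → Y.act π (fn (proj₁ g) x) Y.≈ fn (proj₁ g) x
  supported-map-preserves-fixed (g , _ , g-supported) π fixes {x} πx≈x = begin
    Y.act π (fn g x)                  ≈⟨ Y.act-cong π (fn-cong g (X.sym π⁻¹x≈x)) ⟩
    Y.act π (fn g (X.act (invP π) x)) ≈⟨ g-supported π fixes x ⟩
    fn g x                            ∎
    where
    π⁻¹x≈x : X.act (invP π) x X.≈ x
    π⁻¹x≈x = X.trans (X.act-cong (invP π) (X.sym πx≈x)) (act-inverseˡ X π x)

outl-has-no-supported-section :
  (g : Nominal.Carrier (Exp Bpairs (Bpairs <N Lists))) →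
  ¬ (∀ p → lft (fn (proj₁ g) p) ≈B p)
outl-has-no-supported-section g@(g₀ , A , _) isSection =
  transpose-fixed⇒∉ L a≢b L-fixed a∈L
  where
  a b : Atom
  a = fresh A
  b = fresh (a ∷ A)
  a≢b : a ≢ b
  a≢b a≡b = fresh-∉ (a ∷ A) (here (sym a≡b))
  a∉A : a ∉ A
  a∉A = fresh-∉ A
  b∉A : b ∉ A
  b∉A m = fresh-∉ (a ∷ A) (there m)
  p : APair
  p = ⦅ a , b , a≢b ⦆
  L : List Atom
  L = rgt (fn g₀ p)
  L-fixed : map (transpose a b) L ≡ L
  L-fixed = proj₂ (supported-map-preserves-fixed Bpairs (Bpairs <N Lists) g
    (transposition a b) (transposition-fixes a∉A b∉A)
    (inj₂ (transpose-left a b , transpose-right a b)))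
  a∈L : a ∈ L
  a∈L = ∈supp⇒∈ L (sub (fn g₀ p) a
    (∈supp-resp (Nominal.action Bpairs) {x = p} {y = lft (fn g₀ p)}
      (Nominal.sym Bpairs {lft (fn g₀ p)} {p} (isSection p)) (∈supp-pair a≢b)))

proposition6 : ¬ (Σ Functor λ F → SubStrength F ×
    Σ (NatTransToExp F Bpairs) λ q → ∀ X → Surjective (η q X))
proposition6 (F , subStrength , q , surjective) = outl-has-no-supported-section g isSection
  where
  open Nominal Bpairs using (_≈_)
  open ≈-Reasoning (setoid Bpairs)
  t : Nominal.Carrier (F₀ F Bpairs)
  t = proj₁ (surjective Bpairs (identityExp Bpairs))
  s : Equi (F₀ F Bpairs <N Lists) (F₀ F (Bpairs <N Lists))
  s = proj₁ (subStrength Bpairs Lists)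
  u : Nominal.Carrier (F₀ F (Bpairs <N Lists))
  u = fun s (withSupport (F₀ F Bpairs) t)
  g : Nominal.Carrier (Exp Bpairs (Bpairs <N Lists))
  g = fun (η q (Bpairs <N Lists)) u
  isSection : ∀ p → lft (fn (proj₁ g) p) ≈ p
  isSection p = begin
    lft (fn (proj₁ g) p)
      ≈⟨ natural q (outl Bpairs Lists) u p ⟨
    fn (proj₁ (fun (η q Bpairs) (fun (F₁ F (outl Bpairs Lists)) u))) p
      ≈⟨ cong≈ (η q Bpairs) (proj₂ (subStrength Bpairs Lists) (withSupport (F₀ F Bpairs) t)) p ⟩
    fn (proj₁ (fun (η q Bpairs) t)) p
      ≈⟨ proj₂ (surjective Bpairs (identityExp Bpairs)) p ⟩
    p ∎
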